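{- Let $k$ be a field, $A$ a countable set (of "letters"), and $\diamond$ a commutative, associative $k$-bilinear product on the $k$-vector space $kA$ with basis $A$. Let $*$ be the quasi-shuffle product on the noncommutative polynomial algebra $k\langle A\rangle$. Then for all letters $a,b\in A$ and all words $v,w$ with $v\neq 1\neq w$: \[ a\diamond(v*b)+b(a\diamond v)=(a\diamond v)*b+a\diamond (bv), \] \[ (a\diamond v)*(b\diamond w)=a\diamond\big(v*(b\diamond w)\big)+b\diamond\big((a\diamond v)*w\big)-(a\diamond b)\diamond(v*w), \] and \[ a\big(v*(b\diamond w)\big)+a\diamond(v*bw)+b\big((a\diamond v)*w\big)+b\diamond (av*w)= av*(b\diamond w)+(a\diamond v)*bw+2 (a\diamond b)(v*w). \]
   Context: $k\langle A\rangle$ is the $k$-vector space with basis the words $a_1a_2\cdots a_n$ ($a_i\in A$, $n\ge 0$; the empty word is $1$), with concatenation extended bilinearly; products such as $(a\diamond b)v$ are understood by expanding $a\diamond b\in kA$ linearly. The quasi-shuffle product $*$ is the $k$-bilinear product on $k\langle A\rangle$ with $1*w=w*1=w$ and $(aw)*(bv)=a(w*bv)+b(aw*v)+(a\diamond b)(w*v)$ for letters $a,b$ and words $w,v$. For a letter $a$ and a nonempty word $v=cv'$ ($c\in A$), $a\diamond v$ denotes $(a\diamond c)v'$ (i.e. $\diamond$ acts on the first letter), extended linearly to linear combinations of nonempty words; in particular $a\diamond(bv)=(a\diamond b)v$ and $(a\diamond b)\diamond u$ is defined likewise. -}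

module Defs where

open import Level using (Level; _⊔_; suc)
open import Data.Nat using (ℕ)
open import Data.List using (List; []; _∷_; _++_; map; concatMap)
open import Data.List.Properties using (≡-dec)
open import Data.Product using (_×_; _,_; Σ)
open import Relation.Binary.PropositionalEquality using (_≡_; refl)
open import Relation.Binary.Definitions using (DecidableEquality)
open import Relation.Nullary using (¬_; yes; no)
open import Algebra.Bundles using (CommutativeRing)
open import Function.Bundles using (_↣_; Injection)

record Field (c ℓ : Level) : Set (suc (c ⊔ ℓ)) where
  field
    commutativeRing : CommutativeRing c ℓ
  open CommutativeRing commutativeRing public
  field
    0≉1     : ¬ (0# ≈ 1#)
    inverse : ∀ x → ¬ (x ≈ 0#) → Σ Carrier λ y → x * y ≈ 1#

countable-dec : {A : Set} → A ↣ ℕ → DecidableEquality A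
countable-dec inj x y with Injection.to inj x Data.Nat.≟ Injection.to inj y
... | yes p = yes (Injection.injective inj p)
... | no np = no λ { refl → np refl }

Word : Set → Set
Word A = List A

module QuasiShuffle {c ℓ} (K : Field c ℓ) {A : Set} (_≟A_ : DecidableEquality A)
                    (_◇_ : A → A → List (Field.Carrier K × A)) where
  open Field K

  -- Finite formal k-linear combinations of elements of X, represented as
  -- lists of (coefficient, basis element); equality is coefficientwise.
  Lin : Set → Set c
  Lin X = List (Carrier × X)

  coeffWith : {X : Set} → DecidableEquality X → Lin X → X → Carrier
  coeffWith _≟_ [] u = 0#
  coeffWith _≟_ ((x , w) ∷ xs) u with w ≟ u
  ... | yes _ = x + coeffWith _≟_ xs u
  ... | no  _ = coeffWith _≟_ xs u

  kA : Set c
  kA = Lin A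

  kW : Set c
  kW = Lin (Word A)

  infix 4 _≈A_ _≈W_
  _≈A_ : kA → kA → Set ℓ
  x ≈A y = ∀ l → coeffWith _≟A_ x l ≈ coeffWith _≟A_ y l

  _≈W_ : kW → kW → Set ℓ
  x ≈W y = ∀ u → coeffWith (≡-dec _≟A_) x u ≈ coeffWith (≡-dec _≟A_) y u

  infixl 6 _⊕_ _⊖_
  _⊕_ : {X : Set} → Lin X → Lin X → Lin X
  _⊕_ = _++_

  _·_ : {X : Set} → Carrier → Lin X → Lin X
  r · xs = map (λ { (x , w) → (r * x , w) }) xs

  _⊖_ : {X : Set} → Lin X → Lin X → Lin X
  x ⊖ y = x ⊕ ((- 1#) · y)

  ⟦_⟧ : Word A → kW
  ⟦ w ⟧ = (1# , w) ∷ []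

  _◇ₗ_ : kA → kA → kA
  x ◇ₗ y = concatMap (λ { (r , a) → concatMap (λ { (s , b) → (r * s) · (a ◇ b) }) y }) x

  _⋆_ : kA → kW → kW
  x ⋆ y = concatMap (λ { (r , a) → map (λ { (s , u) → (r * s , a ∷ u) }) y }) x

  _▹_ : A → kW → kW
  a ▹ y = ((1# , a) ∷ []) ⋆ y

  -- x ◇ v for a letter combination x and a word v = c v' : (x ◇ c) v'.
  -- Convention: x ◇ 1 = 0 (never used in the statement, where all arguments
  -- are combinations of nonempty words).
  _◇w_ : kA → Word A → kW
  x ◇w [] = []
  x ◇w (c ∷ v') = (x ◇ₗ ((1# , c) ∷ [])) ⋆ ⟦ v' ⟧

  _◇W_ : kA → kW → kW
  x ◇W y = concatMap (λ { (s , u) → s · (x ◇w u) }) y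

  _◆_ : A → kW → kW
  a ◆ y = ((1# , a) ∷ []) ◇W y

  qsh : Word A → Word A → kW
  qsh [] v = ⟦ v ⟧
  qsh (a ∷ w) [] = ⟦ a ∷ w ⟧
  qsh (a ∷ w) (b ∷ v) =
    (a ▹ qsh w (b ∷ v)) ⊕ (b ▹ qsh (a ∷ w) v) ⊕ ((a ◇ b) ⋆ qsh w v)

  infixl 7 _⊛_
  _⊛_ : kW → kW → kW
  x ⊛ y = concatMap (λ { (r , u) → concatMap (λ { (s , v) → (r * s) · qsh u v }) y }) x

module Submission where

-- Instead of
-- normalising lists we compare them by pairing with arbitrary functionals
-- g : X → k: x ≋ y when Σ rᵢ g(xᵢ) agrees for every g (module Evaluation).
-- Equal coefficients are equivalent to ≋ (Calculus.Coefficients), so ≋ imports the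
-- hypotheses on ◇ and yields the coefficientwise conclusion.  Every operation of
-- Defs pairs with g as a nested pairing against a kernel on basis elements, hence
-- is bilinear, and the structural laws become exchanges of finite sums: a word is
-- its first letter times the rest, ◇ acts on the first letter, and the
-- quasi-shuffle recursion holds for combinations x p, y q with x, y ∈ kA (⊛-⋆).
-- The identities (module Identities) are proved for all such V = x p, W = y q:
-- both sides are expanded by the recursion, the kA-coefficients are matched in
-- the commutative semigroup (kA, ◇), and the sums are rearranged by the
-- commutative-monoid solver.

open import Defs
open import Level using (Level; _⊔_)
open import Data.Nat using (ℕ)
open import Data.List using (List; []; _∷_; _++_; map; concatMap)
open import Data.List.Properties using (≡-dec)
open import Data.Product using (_×_; _,_; proj₁; proj₂)
open import Data.Empty using (⊥-elim)
open import Relation.Binary.PropositionalEquality using (_≢_)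
import Relation.Binary.PropositionalEquality as ≡
open import Relation.Binary.Definitions using (DecidableEquality)
open import Relation.Binary.Bundles using (Setoid)
open import Relation.Nullary using (yes; no; contradiction)
open import Algebra.Bundles using (CommutativeRing; CommutativeMonoid; CommutativeSemigroup)
open import Function.Bundles using (_↣_)

module Evaluation {c ℓ} (R : CommutativeRing c ℓ) where
  open CommutativeRing R
  open import Algebra.Properties.CommutativeSemigroup +-commutativeSemigroup
    using (interchange)
  open import Algebra.Properties.CommutativeSemigroup *-commutativeSemigroup
    using (x∙yz≈y∙xz)
  open import Relation.Binary.Reasoning.Setoid setoid

  Comb : Set → Set c
  Comb X = List (Carrier × X)

  eval : {X : Set} → Comb X → (X → Carrier) → Carrier
  eval []            g = 0#
  eval ((r , a) ∷ x) g = r * g a + eval x g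

  module _ {X : Set} where

    eval-unit : (a : X) (g : X → Carrier) → eval ((1# , a) ∷ []) g ≈ g a
    eval-unit a g = trans (+-identityʳ _) (*-identityˡ (g a))

    eval-++ : (x y : Comb X) (g : X → Carrier) → eval (x ++ y) g ≈ eval x g + eval y g
    eval-++ []            y g = sym (+-identityˡ _)
    eval-++ ((r , a) ∷ x) y g = trans (+-cong refl (eval-++ x y g)) (sym (+-assoc _ _ _))

    eval-cong : (x : Comb X) {g h : X → Carrier} → (∀ a → g a ≈ h a) → eval x g ≈ eval x h
    eval-cong []            g≈h = refl
    eval-cong ((r , a) ∷ x) g≈h = +-cong (*-cong refl (g≈h a)) (eval-cong x g≈h)

    eval-+ : (x : Comb X) (g h : X → Carrier) →
             eval x (λ a → g a + h a) ≈ eval x g + eval x h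
    eval-+ []            g h = sym (+-identityˡ _)
    eval-+ ((r , a) ∷ x) g h =
      trans (+-cong (distribˡ r (g a) (h a)) (eval-+ x g h)) (interchange _ _ _ _)

    eval-* : (x : Comb X) (k : Carrier) (g : X → Carrier) →
             eval x (λ a → k * g a) ≈ k * eval x g
    eval-* []            k g = sym (zeroʳ k)
    eval-* ((r , a) ∷ x) k g =
      trans (+-cong (x∙yz≈y∙xz r k (g a)) (eval-* x k g)) (sym (distribˡ k _ _))

    eval-0 : (x : Comb X) → eval x (λ _ → 0#) ≈ 0#
    eval-0 []            = refl
    eval-0 ((r , a) ∷ x) = trans (+-cong (zeroʳ r) (eval-0 x)) (+-identityʳ 0#)

  eval-swap : {X Y : Set} (x : Comb X) (y : Comb Y) (h : X → Y → Carrier) →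
              eval x (λ a → eval y (h a)) ≈ eval y (λ b → eval x (λ a → h a b))
  eval-swap []            y h = sym (eval-0 y)
  eval-swap ((r , a) ∷ x) y h = begin
      r * eval y (h a) + eval x (λ a′ → eval y (h a′))
    ≈⟨ +-cong (sym (eval-* y r (h a))) (eval-swap x y h) ⟩
      eval y (λ b → r * h a b) + eval y (λ b → eval x (λ a′ → h a′ b))
    ≈⟨ sym (eval-+ y _ _) ⟩
      eval y (λ b → r * h a b + eval x (λ a′ → h a′ b)) ∎

  eval-concatMap : {X Y : Set} (f : Carrier × X → Comb Y) (x : Comb X)
                   {g : Y → Carrier} {h : X → Carrier} →
                   (∀ r a → eval (f (r , a)) g ≈ r * h a) →
                   eval (concatMap f x) g ≈ eval x h
  eval-concatMap f []            f≈h = refl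
  eval-concatMap f ((r , a) ∷ x) {g} f≈h =
    trans (eval-++ (f (r , a)) (concatMap f x) g) (+-cong (f≈h r a) (eval-concatMap f x f≈h))

  eval-map : {X Y : Set} (φ : Carrier × X → Carrier × Y) (x : Comb X)
             {g : Y → Carrier} {h : X → Carrier} →
             (∀ r a → proj₁ (φ (r , a)) * g (proj₂ (φ (r , a))) ≈ r * h a) →
             eval (map φ x) g ≈ eval x h
  eval-map φ []            φ≈h = refl
  eval-map φ ((r , a) ∷ x) φ≈h = +-cong (φ≈h r a) (eval-map φ x φ≈h)

  infix 4 _≋_
  record _≋_ {X : Set} (x y : Comb X) : Set (c ⊔ ℓ) where
    constructor mk≋
    field eval-≈ : ∀ g → eval x g ≈ eval y g
  open _≋_ public

  module _ {X : Set} where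

    ≋-refl : {x : Comb X} → x ≋ x
    ≋-refl = mk≋ λ g → refl

    ≋-sym : {x y : Comb X} → x ≋ y → y ≋ x
    ≋-sym x≋y = mk≋ λ g → sym (eval-≈ x≋y g)

    ≋-trans : {x y z : Comb X} → x ≋ y → y ≋ z → x ≋ z
    ≋-trans x≋y y≋z = mk≋ λ g → trans (eval-≈ x≋y g) (eval-≈ y≋z g)

    ++-cong : {x x′ y y′ : Comb X} → x ≋ x′ → y ≋ y′ → (x ++ y) ≋ (x′ ++ y′)
    ++-cong {x} {x′} {y} {y′} x≋x′ y≋y′ = mk≋ λ g → begin
      eval (x ++ y) g          ≈⟨ eval-++ x y g ⟩
      eval x g + eval y g      ≈⟨ +-cong (eval-≈ x≋x′ g) (eval-≈ y≋y′ g) ⟩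
      eval x′ g + eval y′ g    ≈⟨ sym (eval-++ x′ y′ g) ⟩
      eval (x′ ++ y′) g        ∎

  ≋-setoid : Set → Setoid c (c ⊔ ℓ)
  ≋-setoid X = record
    { Carrier       = Comb X
    ; _≈_           = _≋_
    ; isEquivalence = record { refl = ≋-refl ; sym = ≋-sym ; trans = ≋-trans }
    }

  ++-commutativeMonoid : Set → CommutativeMonoid c (c ⊔ ℓ)
  ++-commutativeMonoid X = record
    { Carrier             = Comb X
    ; _≈_                 = _≋_
    ; _∙_                 = _++_
    ; ε                   = []
    ; isCommutativeMonoid = record
      { isMonoid = record
        { isSemigroup = record
          { isMagma = record
            { isEquivalence = Setoid.isEquivalence (≋-setoid X)
            ; ∙-cong        = ++-cong }
          ; assoc = λ x y z → mk≋ λ g → begin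
              eval ((x ++ y) ++ z) g            ≈⟨ trans (eval-++ (x ++ y) z g) (+-cong (eval-++ x y g) refl) ⟩
              eval x g + eval y g + eval z g    ≈⟨ +-assoc _ _ _ ⟩
              eval x g + (eval y g + eval z g)  ≈⟨ sym (trans (eval-++ x (y ++ z) g) (+-cong refl (eval-++ y z g))) ⟩
              eval (x ++ (y ++ z)) g            ∎ }
        ; identity = (λ x → ≋-refl)
                   , (λ x → mk≋ λ g → trans (eval-++ x [] g) (+-identityʳ _)) }
      ; comm = λ x y → mk≋ λ g →
          trans (eval-++ x y g) (trans (+-comm _ _) (sym (eval-++ y x g))) }
    }

module Calculus {c ℓ} (K : Field c ℓ) {A : Set} (_≟A_ : DecidableEquality A)
                (_◇_ : A → A → List (Field.Carrier K × A)) where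
  open Field K
  open QuasiShuffle K _≟A_ _◇_
  open Evaluation commutativeRing
  open import Algebra.Properties.CommutativeSemigroup +-commutativeSemigroup
    using (x∙yz≈y∙xz)
  open import Algebra.Properties.CommutativeSemigroup *-commutativeSemigroup
    using () renaming (x∙yz≈y∙xz to *-left-comm)
  open import Algebra.Properties.Ring ring using (-1*x≈-x)
  open import Algebra.Properties.Group +-group using (x∙y⁻¹≈ε⇒x≈y)
  open import Relation.Binary.Reasoning.Setoid setoid

  rescale : ∀ r s t → (r * s) * t ≈ s * (r * t)
  rescale r s t = trans (*-assoc r s t) (*-left-comm r s t)

  eval-· : {X : Set} (r : Carrier) (x : Lin X) (g : X → Carrier) → eval (r · x) g ≈ r * eval x g
  eval-· r x g = trans (eval-map _ x λ s a → rescale r s (g a)) (eval-* x r g)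

  eval-⊖ : {X : Set} (x y : Lin X) (g : X → Carrier) → eval (x ⊖ y) g ≈ eval x g - eval y g
  eval-⊖ x y g = trans (eval-++ x _ g) (+-cong refl (trans (eval-· (- 1#) y g) (-1*x≈-x _)))

  module Coefficients {X : Set} (_≟_ : DecidableEquality X) where

    coeff : Lin X → X → Carrier
    coeff = coeffWith _≟_

    indicator : X → X → Carrier
    indicator u w with w ≟ u
    ... | yes _ = 1#
    ... | no  _ = 0#

    coeff-eval : (x : Lin X) (u : X) → coeff x u ≈ eval x (indicator u)
    coeff-eval []            u = refl
    coeff-eval ((r , w) ∷ x) u with w ≟ u
    ... | yes _ = +-cong (sym (*-identityʳ r)) (coeff-eval x u)
    ... | no  _ = trans (coeff-eval x u) (sym (trans (+-cong (zeroʳ r) refl) (+-identityˡ _)))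

    punch : X → (X → Carrier) → X → Carrier
    punch u g w with w ≟ u
    ... | yes _ = 0#
    ... | no  _ = g w

    punch-self : (u : X) (g : X → Carrier) → punch u g u ≈ 0#
    punch-self u g with u ≟ u
    ... | yes _  = refl
    ... | no u≢u = contradiction ≡.refl u≢u

    eval-punch : (x : Lin X) (u : X) (g : X → Carrier) →
                 eval x g ≈ coeff x u * g u + eval x (punch u g)
    eval-punch []            u g = sym (trans (+-cong (zeroˡ (g u)) refl) (+-identityʳ 0#))
    eval-punch ((r , w) ∷ x) u g with w ≟ u
    ... | yes ≡.refl = begin
        r * g w + eval x g
      ≈⟨ +-cong refl (eval-punch x w g) ⟩
        r * g w + (coeff x w * g w + eval x (punch w g))
      ≈⟨ sym (+-assoc _ _ _) ⟩
        (r * g w + coeff x w * g w) + eval x (punch w g)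
      ≈⟨ +-cong (sym (distribʳ (g w) r (coeff x w))) (sym (trans (+-cong (zeroʳ r) refl) (+-identityˡ _))) ⟩
        (r + coeff x w) * g w + (r * 0# + eval x (punch w g)) ∎
    ... | no _ = trans (+-cong refl (eval-punch x u g)) (x∙yz≈y∙xz _ _ _)

    eval-vanish : (x : Lin X) (g : X → Carrier) →
                  (∀ u → coeff x u * g u ≈ 0#) → eval x g ≈ 0#
    eval-vanish []            g _    = refl
    eval-vanish ((r , w) ∷ x) g annihilates = begin
        eval ((r , w) ∷ x) g
      ≈⟨ eval-punch ((r , w) ∷ x) w g ⟩
        coeff ((r , w) ∷ x) w * g w + (r * punch w g w + eval x (punch w g))
      ≈⟨ +-cong (annihilates w) (+-cong (*-cong refl (punch-self w g)) refl) ⟩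
        0# + (r * 0# + eval x (punch w g))
      ≈⟨ trans (+-identityˡ _) (trans (+-cong (zeroʳ r) refl) (+-identityˡ _)) ⟩
        eval x (punch w g)
      ≈⟨ eval-vanish x (punch w g) annihilates-rest ⟩
        0# ∎
      where
      annihilates-rest : ∀ u → coeff x u * punch w g u ≈ 0#
      annihilates-rest u with u ≟ w
      ... | yes _ = zeroʳ _
      ... | no u≢w with w ≟ u | annihilates u
      ...   | yes w≡u | _             = contradiction (≡.sym w≡u) u≢w
      ...   | no  _   | annihilates-u = annihilates-u

    -- Equal coefficients give ≋: the difference x ⊖ y vanishes against every g.
    coeff⇒≋ : (x y : Lin X) → (∀ u → coeff x u ≈ coeff y u) → x ≋ y
    coeff⇒≋ x y x≈y = mk≋ λ g →
      x∙y⁻¹≈ε⇒x≈y _ _ (trans (sym (eval-⊖ x y g)) (eval-vanish (x ⊖ y) g λ u →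
        trans (*-cong (difference-vanishes u) refl) (zeroˡ (g u))))
      where
      difference-vanishes : ∀ u → coeff (x ⊖ y) u ≈ 0#
      difference-vanishes u = begin
        coeff (x ⊖ y) u                                   ≈⟨ coeff-eval (x ⊖ y) u ⟩
        eval (x ⊖ y) (indicator u)                        ≈⟨ eval-⊖ x y (indicator u) ⟩
        eval x (indicator u) - eval y (indicator u)       ≈⟨ +-cong (sym (coeff-eval x u)) (-‿cong (sym (coeff-eval y u))) ⟩
        coeff x u - coeff y u                             ≈⟨ +-cong (x≈y u) refl ⟩
        coeff y u - coeff y u                             ≈⟨ -‿inverseʳ _ ⟩
        0#                                                ∎

    ≋⇒coeff : {x y : Lin X} → x ≋ y → ∀ u → coeff x u ≈ coeff y u
    ≋⇒coeff {x} {y} x≋y u =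
      trans (coeff-eval x u) (trans (eval-≈ x≋y (indicator u)) (sym (coeff-eval y u)))

  ⟪_⟫ : A → kA
  ⟪ a ⟫ = (1# , a) ∷ []

  eval-⋆ : (x : kA) (y : kW) (g : Word A → Carrier) →
           eval (x ⋆ y) g ≈ eval x (λ a → eval y (λ u → g (a ∷ u)))
  eval-⋆ x y g = eval-concatMap _ x λ r a →
    trans (eval-map _ y λ s u → rescale r s (g (a ∷ u))) (eval-* y r _)

  eval-▹ : (a : A) (y : kW) (g : Word A → Carrier) → eval (a ▹ y) g ≈ eval y (λ u → g (a ∷ u))
  eval-▹ a y g = trans (eval-⋆ ⟪ a ⟫ y g) (eval-unit a (λ b → eval y (λ u → g (b ∷ u))))

  eval-◇ₗ : (x y : kA) (f : A → Carrier) →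
            eval (x ◇ₗ y) f ≈ eval x (λ a → eval y (λ b → eval (a ◇ b) f))
  eval-◇ₗ x y f = eval-concatMap _ x λ r a →
    trans (eval-concatMap _ y λ s b → trans (eval-· (r * s) (a ◇ b) f) (rescale r s _))
          (eval-* y r _)

  eval-⊛ : (x y : kW) (g : Word A → Carrier) →
           eval (x ⊛ y) g ≈ eval x (λ u → eval y (λ v → eval (qsh u v) g))
  eval-⊛ x y g = eval-concatMap _ x λ r u →
    trans (eval-concatMap _ y λ s v → trans (eval-· (r * s) (qsh u v) g) (rescale r s _))
          (eval-* y r _)

  act : A → Word A → (Word A → Carrier) → Carrier
  act a []      g = 0#
  act a (c ∷ u) g = eval (a ◇ c) (λ d → g (d ∷ u))

  eval-◇w : (x : kA) (u : Word A) (g : Word A → Carrier) → eval (x ◇w u) g ≈ eval x (λ a → act a u g)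
  eval-◇w x []      g = sym (eval-0 x)
  eval-◇w x (c ∷ u) g = begin
    eval ((x ◇ₗ ⟪ c ⟫) ⋆ ⟦ u ⟧) g                              ≈⟨ eval-⋆ (x ◇ₗ ⟪ c ⟫) ⟦ u ⟧ g ⟩
    eval (x ◇ₗ ⟪ c ⟫) (λ d → eval ⟦ u ⟧ (λ v → g (d ∷ v)))    ≈⟨ eval-cong (x ◇ₗ ⟪ c ⟫) (λ d → eval-unit u (λ v → g (d ∷ v))) ⟩
    eval (x ◇ₗ ⟪ c ⟫) (λ d → g (d ∷ u))                        ≈⟨ eval-◇ₗ x ⟪ c ⟫ _ ⟩
    eval x (λ a → eval ⟪ c ⟫ (λ b → act a (b ∷ u) g))          ≈⟨ eval-cong x (λ a → eval-unit c (λ b → act a (b ∷ u) g)) ⟩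
    eval x (λ a → act a (c ∷ u) g)                              ∎

  eval-◇W : (x : kA) (y : kW) (g : Word A → Carrier) →
            eval (x ◇W y) g ≈ eval x (λ a → eval y (λ u → act a u g))
  eval-◇W x y g = begin
    eval (x ◇W y) g                           ≈⟨ eval-concatMap _ y (λ s u → eval-· s (x ◇w u) g) ⟩
    eval y (λ u → eval (x ◇w u) g)            ≈⟨ eval-cong y (λ u → eval-◇w x u g) ⟩
    eval y (λ u → eval x (λ a → act a u g))   ≈⟨ eval-swap y x _ ⟩
    eval x (λ a → eval y (λ u → act a u g))   ∎

  module Bilinear {X Y Z : Set} (F : Lin X → Lin Y → Lin Z)
                  (kernel : (Z → Carrier) → X → Y → Carrier)
                  (eval-F : ∀ x y g → eval (F x y) g ≈ eval x (λ a → eval y (kernel g a))) where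

    F-cong : {x x′ : Lin X} {y y′ : Lin Y} → x ≋ x′ → y ≋ y′ → F x y ≋ F x′ y′
    F-cong {x} {x′} {y} {y′} x≋x′ y≋y′ = mk≋ λ g → begin
      eval (F x y) g                          ≈⟨ eval-F x y g ⟩
      eval x (λ a → eval y (kernel g a))      ≈⟨ eval-≈ x≋x′ _ ⟩
      eval x′ (λ a → eval y (kernel g a))     ≈⟨ eval-cong x′ (λ a → eval-≈ y≋y′ _) ⟩
      eval x′ (λ a → eval y′ (kernel g a))    ≈⟨ sym (eval-F x′ y′ g) ⟩
      eval (F x′ y′) g                        ∎

    F-congˡ : {x x′ : Lin X} (y : Lin Y) → x ≋ x′ → F x y ≋ F x′ y
    F-congˡ y x≋x′ = F-cong x≋x′ (≋-refl {x = y})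

    F-congʳ : (x : Lin X) {y y′ : Lin Y} → y ≋ y′ → F x y ≋ F x y′
    F-congʳ x y≋y′ = F-cong (≋-refl {x = x}) y≋y′

    distrib-⊕ : (x : Lin X) (y z : Lin Y) → F x (y ⊕ z) ≋ F x y ⊕ F x z
    distrib-⊕ x y z = mk≋ λ g → begin
      eval (F x (y ⊕ z)) g                                             ≈⟨ eval-F x (y ⊕ z) g ⟩
      eval x (λ a → eval (y ⊕ z) (kernel g a))                         ≈⟨ eval-cong x (λ a → eval-++ y z _) ⟩
      eval x (λ a → eval y (kernel g a) + eval z (kernel g a))         ≈⟨ eval-+ x _ _ ⟩
      eval x (λ a → eval y (kernel g a)) + eval x (λ a → eval z (kernel g a))
                                                                       ≈⟨ sym (+-cong (eval-F x y g) (eval-F x z g)) ⟩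
      eval (F x y) g + eval (F x z) g                                  ≈⟨ sym (eval-++ (F x y) (F x z) g) ⟩
      eval (F x y ⊕ F x z) g                                           ∎

  open Bilinear _⋆_  (λ g a u → g (a ∷ u))         eval-⋆  public using ()
    renaming (F-congˡ to ⋆-congˡ; F-congʳ to ⋆-congʳ)
  open Bilinear _◇ₗ_ (λ f a b → eval (a ◇ b) f)    eval-◇ₗ public using ()
    renaming (F-cong to ◇ₗ-cong)
  open Bilinear _⊛_  (λ g u v → eval (qsh u v) g)  eval-⊛  public using ()
    renaming (F-cong to ⊛-cong; F-congˡ to ⊛-congˡ; F-congʳ to ⊛-congʳ)
  open Bilinear _◇W_ (λ g a u → act a u g)         eval-◇W public using ()
    renaming (F-congˡ to ◇W-congˡ; F-congʳ to ◇W-congʳ; distrib-⊕ to ◇W-distrib-⊕)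

  ·-cong : {X : Set} (r : Carrier) {x x′ : Lin X} → x ≋ x′ → r · x ≋ r · x′
  ·-cong r {x} {x′} x≋x′ = mk≋ λ g →
    trans (eval-· r x g) (trans (*-cong refl (eval-≈ x≋x′ g)) (sym (eval-· r x′ g)))

  ⊖-cong : {X : Set} {x x′ y y′ : Lin X} → x ≋ x′ → y ≋ y′ → x ⊖ y ≋ x′ ⊖ y′
  ⊖-cong x≋x′ y≋y′ = ++-cong x≋x′ (·-cong (- 1#) y≋y′)

  ⊖-cancel : {X : Set} (x y : Lin X) → (x ⊕ y) ⊖ y ≋ x
  ⊖-cancel x y = mk≋ λ g → begin
    eval ((x ⊕ y) ⊖ y) g              ≈⟨ eval-⊖ (x ⊕ y) y g ⟩
    eval (x ⊕ y) g - eval y g         ≈⟨ +-cong (eval-++ x y g) refl ⟩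
    eval x g + eval y g - eval y g    ≈⟨ +-assoc _ _ _ ⟩
    eval x g + (eval y g - eval y g)  ≈⟨ +-cong refl (-‿inverseʳ _) ⟩
    eval x g + 0#                     ≈⟨ +-identityʳ _ ⟩
    eval x g                          ∎

  ⊕-double : {X : Set} (x : Lin X) → x ⊕ x ≋ (1# + 1#) · x
  ⊕-double x = mk≋ λ g → begin
    eval (x ⊕ x) g              ≈⟨ eval-++ x x g ⟩
    eval x g + eval x g         ≈⟨ sym (+-cong (*-identityˡ _) (*-identityˡ _)) ⟩
    1# * eval x g + 1# * eval x g ≈⟨ sym (distribʳ _ 1# 1#) ⟩
    (1# + 1#) * eval x g        ≈⟨ sym (eval-· (1# + 1#) x g) ⟩
    eval ((1# + 1#) · x) g      ∎

  split-word : (c : A) (u : Word A) → ⟦ c ∷ u ⟧ ≋ ⟪ c ⟫ ⋆ ⟦ u ⟧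
  split-word c u = mk≋ λ g → begin
    eval ⟦ c ∷ u ⟧ g                                     ≈⟨ eval-unit (c ∷ u) g ⟩
    g (c ∷ u)                                            ≈⟨ sym (eval-unit u (λ v → g (c ∷ v))) ⟩
    eval ⟦ u ⟧ (λ v → g (c ∷ v))                         ≈⟨ sym (eval-unit c (λ a → eval ⟦ u ⟧ (λ v → g (a ∷ v)))) ⟩
    eval ⟪ c ⟫ (λ a → eval ⟦ u ⟧ (λ v → g (a ∷ v)))      ≈⟨ sym (eval-⋆ ⟪ c ⟫ ⟦ u ⟧ g) ⟩
    eval (⟪ c ⟫ ⋆ ⟦ u ⟧) g                               ∎

  ⊛-unitʳ : (p : kW) → p ⊛ ⟦ [] ⟧ ≋ p
  ⊛-unitʳ p = mk≋ λ g → trans (eval-⊛ p ⟦ [] ⟧ g) (eval-cong p λ u →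
    trans (eval-unit [] (λ v → eval (qsh u v) g)) (qsh-[] u g))
    where
    qsh-[] : (u : Word A) (g : Word A → Carrier) → eval (qsh u []) g ≈ g u
    qsh-[] []      g = eval-unit [] g
    qsh-[] (a ∷ u) g = eval-unit (a ∷ u) g

  ◇ₗ-letters : (a b : A) → ⟪ a ⟫ ◇ₗ ⟪ b ⟫ ≋ a ◇ b
  ◇ₗ-letters a b = mk≋ λ f → begin
    eval (⟪ a ⟫ ◇ₗ ⟪ b ⟫) f                                  ≈⟨ eval-◇ₗ ⟪ a ⟫ ⟪ b ⟫ f ⟩
    eval ⟪ a ⟫ (λ a′ → eval ⟪ b ⟫ (λ b′ → eval (a′ ◇ b′) f))  ≈⟨ eval-unit a (λ a′ → eval ⟪ b ⟫ (λ b′ → eval (a′ ◇ b′) f)) ⟩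
    eval ⟪ b ⟫ (λ b′ → eval (a ◇ b′) f)                      ≈⟨ eval-unit b (λ b′ → eval (a ◇ b′) f) ⟩
    eval (a ◇ b) f                                           ∎

  ◇W-⋆ : (α y : kA) (p : kW) → α ◇W (y ⋆ p) ≋ (α ◇ₗ y) ⋆ p
  ◇W-⋆ α y p = mk≋ λ g → begin
      eval (α ◇W (y ⋆ p)) g
    ≈⟨ eval-◇W α (y ⋆ p) g ⟩
      eval α (λ a → eval (y ⋆ p) (λ u → act a u g))
    ≈⟨ eval-cong α (λ a → eval-⋆ y p _) ⟩
      eval α (λ a → eval y (λ b → eval p (λ u → eval (a ◇ b) (λ d → g (d ∷ u)))))
    ≈⟨ eval-cong α (λ a → eval-cong y (λ b → eval-swap p (a ◇ b) _)) ⟩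
      eval α (λ a → eval y (λ b → eval (a ◇ b) (λ d → eval p (λ u → g (d ∷ u)))))
    ≈⟨ sym (eval-◇ₗ α y _) ⟩
      eval (α ◇ₗ y) (λ d → eval p (λ u → g (d ∷ u)))
    ≈⟨ sym (eval-⋆ (α ◇ₗ y) p g) ⟩
      eval ((α ◇ₗ y) ⋆ p) g ∎

  eval₄ : kA → kW → kA → kW → (A → Word A → A → Word A → Carrier) → Carrier
  eval₄ x p y q Φ = eval x (λ a → eval p (λ u → eval y (λ b → eval q (λ v → Φ a u b v))))

  eval₄-cong : (x : kA) (p : kW) (y : kA) (q : kW) {Φ Ψ : A → Word A → A → Word A → Carrier} →
               (∀ a u b v → Φ a u b v ≈ Ψ a u b v) → eval₄ x p y q Φ ≈ eval₄ x p y q Ψ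
  eval₄-cong x p y q Φ≈Ψ =
    eval-cong x λ a → eval-cong p λ u → eval-cong y λ b → eval-cong q λ v → Φ≈Ψ a u b v

  eval₄-+ : (x : kA) (p : kW) (y : kA) (q : kW) (Φ Ψ : A → Word A → A → Word A → Carrier) →
            eval₄ x p y q (λ a u b v → Φ a u b v + Ψ a u b v) ≈ eval₄ x p y q Φ + eval₄ x p y q Ψ
  eval₄-+ x p y q Φ Ψ =
    trans (eval-cong x λ a →
             trans (eval-cong p λ u → trans (eval-cong y λ b → eval-+ q _ _) (eval-+ y _ _))
                   (eval-+ p _ _))
          (eval-+ x _ _)

  eval-⊕₃ : {X : Set} (x y z : Lin X) (g : X → Carrier) →
            eval (x ⊕ y ⊕ z) g ≈ eval x g + eval y g + eval z g
  eval-⊕₃ x y z g = trans (eval-++ (x ⊕ y) z g) (+-cong (eval-++ x y g) refl)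

  eval-product : (x : kA) (p : kW) (y : kA) (q : kW) (g : Word A → Carrier) →
    eval ((x ⋆ p) ⊛ (y ⋆ q)) g ≈ eval₄ x p y q (λ a u b v → eval (qsh (a ∷ u) (b ∷ v)) g)
  eval-product x p y q g = begin
      eval ((x ⋆ p) ⊛ (y ⋆ q)) g
    ≈⟨ eval-⊛ (x ⋆ p) (y ⋆ q) g ⟩
      eval (x ⋆ p) (λ U → eval (y ⋆ q) (λ V → eval (qsh U V) g))
    ≈⟨ eval-⋆ x p _ ⟩
      eval x (λ a → eval p (λ u → eval (y ⋆ q) (λ V → eval (qsh (a ∷ u) V) g)))
    ≈⟨ eval-cong x (λ a → eval-cong p (λ u → eval-⋆ y q _)) ⟩
      eval₄ x p y q (λ a u b v → eval (qsh (a ∷ u) (b ∷ v)) g) ∎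

  eval-left-term : (x : kA) (p : kW) (y : kA) (q : kW) (g : Word A → Carrier) →
    eval (x ⋆ (p ⊛ (y ⋆ q))) g ≈ eval₄ x p y q (λ a u b v → eval (a ▹ qsh u (b ∷ v)) g)
  eval-left-term x p y q g = begin
      eval (x ⋆ (p ⊛ (y ⋆ q))) g
    ≈⟨ eval-⋆ x (p ⊛ (y ⋆ q)) g ⟩
      eval x (λ a → eval (p ⊛ (y ⋆ q)) (λ t → g (a ∷ t)))
    ≈⟨ eval-cong x (λ a → eval-⊛ p (y ⋆ q) _) ⟩
      eval x (λ a → eval p (λ u → eval (y ⋆ q) (λ V → eval (qsh u V) (λ t → g (a ∷ t)))))
    ≈⟨ eval-cong x (λ a → eval-cong p (λ u → eval-⋆ y q _)) ⟩
      eval₄ x p y q (λ a u b v → eval (qsh u (b ∷ v)) (λ t → g (a ∷ t)))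
    ≈⟨ eval₄-cong x p y q (λ a u b v → sym (eval-▹ a (qsh u (b ∷ v)) g)) ⟩
      eval₄ x p y q (λ a u b v → eval (a ▹ qsh u (b ∷ v)) g) ∎

  eval-right-term : (x : kA) (p : kW) (y : kA) (q : kW) (g : Word A → Carrier) →
    eval (y ⋆ ((x ⋆ p) ⊛ q)) g ≈ eval₄ x p y q (λ a u b v → eval (b ▹ qsh (a ∷ u) v) g)
  eval-right-term x p y q g = begin
      eval (y ⋆ ((x ⋆ p) ⊛ q)) g
    ≈⟨ eval-⋆ y ((x ⋆ p) ⊛ q) g ⟩
      eval y (λ b → eval ((x ⋆ p) ⊛ q) (λ t → g (b ∷ t)))
    ≈⟨ eval-cong y (λ b → eval-⊛ (x ⋆ p) q _) ⟩
      eval y (λ b → eval (x ⋆ p) (λ U → eval q (λ v → eval (qsh U v) (λ t → g (b ∷ t)))))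
    ≈⟨ eval-cong y (λ b → eval-⋆ x p _) ⟩
      eval y (λ b → eval x (λ a → eval p (λ u → eval q (λ v → eval (qsh (a ∷ u) v) (λ t → g (b ∷ t))))))
    ≈⟨ eval-swap y x _ ⟩
      eval x (λ a → eval y (λ b → eval p (λ u → eval q (λ v → eval (qsh (a ∷ u) v) (λ t → g (b ∷ t))))))
    ≈⟨ eval-cong x (λ a → eval-swap y p _) ⟩
      eval₄ x p y q (λ a u b v → eval (qsh (a ∷ u) v) (λ t → g (b ∷ t)))
    ≈⟨ eval₄-cong x p y q (λ a u b v → sym (eval-▹ b (qsh (a ∷ u) v) g)) ⟩
      eval₄ x p y q (λ a u b v → eval (b ▹ qsh (a ∷ u) v) g) ∎

  eval-merge-term : (x : kA) (p : kW) (y : kA) (q : kW) (g : Word A → Carrier) →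
    eval ((x ◇ₗ y) ⋆ (p ⊛ q)) g ≈ eval₄ x p y q (λ a u b v → eval ((a ◇ b) ⋆ qsh u v) g)
  eval-merge-term x p y q g = begin
      eval ((x ◇ₗ y) ⋆ (p ⊛ q)) g
    ≈⟨ eval-⋆ (x ◇ₗ y) (p ⊛ q) g ⟩
      eval (x ◇ₗ y) (λ d → eval (p ⊛ q) (λ t → g (d ∷ t)))
    ≈⟨ eval-◇ₗ x y _ ⟩
      eval x (λ a → eval y (λ b → eval (a ◇ b) (λ d → eval (p ⊛ q) (λ t → g (d ∷ t)))))
    ≈⟨ eval-cong x (λ a → eval-cong y (λ b → eval-cong (a ◇ b) (λ d → eval-⊛ p q _))) ⟩
      eval x (λ a → eval y (λ b → eval (a ◇ b) (λ d →
        eval p (λ u → eval q (λ v → eval (qsh u v) (λ t → g (d ∷ t)))))))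
    ≈⟨ eval-cong x (λ a → eval-cong y (λ b → eval-swap (a ◇ b) p _)) ⟩
      eval x (λ a → eval y (λ b → eval p (λ u → eval (a ◇ b) (λ d →
        eval q (λ v → eval (qsh u v) (λ t → g (d ∷ t)))))))
    ≈⟨ eval-cong x (λ a → eval-cong y (λ b → eval-cong p (λ u → eval-swap (a ◇ b) q _))) ⟩
      eval x (λ a → eval y (λ b → eval p (λ u → eval q (λ v → eval (a ◇ b) (λ d →
        eval (qsh u v) (λ t → g (d ∷ t)))))))
    ≈⟨ eval-cong x (λ a → eval-swap y p _) ⟩
      eval₄ x p y q (λ a u b v → eval (a ◇ b) (λ d → eval (qsh u v) (λ t → g (d ∷ t))))
    ≈⟨ eval₄-cong x p y q (λ a u b v → sym (eval-⋆ (a ◇ b) (qsh u v) g)) ⟩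
      eval₄ x p y q (λ a u b v → eval ((a ◇ b) ⋆ qsh u v) g) ∎

  ⊛-⋆ : (x : kA) (p : kW) (y : kA) (q : kW) →
        (x ⋆ p) ⊛ (y ⋆ q) ≋ x ⋆ (p ⊛ (y ⋆ q)) ⊕ y ⋆ ((x ⋆ p) ⊛ q) ⊕ (x ◇ₗ y) ⋆ (p ⊛ q)
  ⊛-⋆ x p y q = mk≋ λ g → begin
      eval ((x ⋆ p) ⊛ (y ⋆ q)) g
    ≈⟨ eval-product x p y q g ⟩
      eval₄ x p y q (λ a u b v → eval (qsh (a ∷ u) (b ∷ v)) g)
    ≈⟨ eval₄-cong x p y q (λ a u b v → eval-⊕₃ (a ▹ qsh u (b ∷ v)) (b ▹ qsh (a ∷ u) v) ((a ◇ b) ⋆ qsh u v) g) ⟩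
      eval₄ x p y q (λ a u b v → eval (a ▹ qsh u (b ∷ v)) g + eval (b ▹ qsh (a ∷ u) v) g
                                 + eval ((a ◇ b) ⋆ qsh u v) g)
    ≈⟨ trans (eval₄-+ x p y q _ _) (+-cong (eval₄-+ x p y q _ _) refl) ⟩
      eval₄ x p y q (λ a u b v → eval (a ▹ qsh u (b ∷ v)) g)
      + eval₄ x p y q (λ a u b v → eval (b ▹ qsh (a ∷ u) v) g)
      + eval₄ x p y q (λ a u b v → eval ((a ◇ b) ⋆ qsh u v) g)
    ≈⟨ sym (+-cong (+-cong (eval-left-term x p y q g) (eval-right-term x p y q g))
                   (eval-merge-term x p y q g)) ⟩
      eval (x ⋆ (p ⊛ (y ⋆ q))) g + eval (y ⋆ ((x ⋆ p) ⊛ q)) g + eval ((x ◇ₗ y) ⋆ (p ⊛ q)) g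
    ≈⟨ sym (eval-⊕₃ (x ⋆ (p ⊛ (y ⋆ q))) (y ⋆ ((x ⋆ p) ⊛ q)) ((x ◇ₗ y) ⋆ (p ⊛ q)) g) ⟩
      eval (x ⋆ (p ⊛ (y ⋆ q)) ⊕ y ⋆ ((x ⋆ p) ⊛ q) ⊕ (x ◇ₗ y) ⋆ (p ⊛ q)) g ∎

  -- A combination of nonempty words presented as x p with x ∈ kA, p ∈ k⟨A⟩;
  -- the identities hold for all such V, in particular for nonempty words.
  record Prefixed (V : kW) : Set (c ⊔ ℓ) where
    constructor prefixed
    field
      head  : kA
      tail  : kW
      split : V ≋ head ⋆ tail
  open Prefixed

  word-prefixed : (c : A) (u : Word A) → Prefixed ⟦ c ∷ u ⟧
  word-prefixed c u = prefixed ⟪ c ⟫ ⟦ u ⟧ (split-word c u)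

  ⋆-prefixed : (x : kA) (V : kW) → Prefixed (x ⋆ V)
  ⋆-prefixed x V = prefixed x V ≋-refl

  ◇W-prefixed : (α : kA) {V : kW} → Prefixed V → Prefixed (α ◇W V)
  ◇W-prefixed α hV =
    prefixed (α ◇ₗ head hV) (tail hV) (≋-trans (◇W-congʳ α (split hV)) (◇W-⋆ α (head hV) (tail hV)))

  ⊕₃-cong : {X : Set} {x x′ y y′ z z′ : Lin X} → x ≋ x′ → y ≋ y′ → z ≋ z′ → x ⊕ y ⊕ z ≋ x′ ⊕ y′ ⊕ z′
  ⊕₃-cong x≋x′ y≋y′ z≋z′ = ++-cong (++-cong x≋x′ y≋y′) z≋z′

  ⊛-split : {V W : kW} (hV : Prefixed V) (hW : Prefixed W) →
            V ⊛ W ≋ head hV ⋆ (tail hV ⊛ W) ⊕ head hW ⋆ (V ⊛ tail hW)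
                    ⊕ (head hV ◇ₗ head hW) ⋆ (tail hV ⊛ tail hW)
  ⊛-split (prefixed x p V≋xp) (prefixed y q W≋yq) =
    ≋-trans (⊛-cong V≋xp W≋yq) (≋-trans (⊛-⋆ x p y q)
      (⊕₃-cong (⋆-congʳ x (⊛-congʳ p (≋-sym W≋yq)))
               (⋆-congʳ y (⊛-congˡ q (≋-sym V≋xp)))
               (≋-refl {x = (x ◇ₗ y) ⋆ (p ⊛ q)})))

  ◇W-⊛-split : (α : kA) {V W : kW} (hV : Prefixed V) (hW : Prefixed W) →
               α ◇W (V ⊛ W) ≋ (α ◇ₗ head hV) ⋆ (tail hV ⊛ W) ⊕ (α ◇ₗ head hW) ⋆ (V ⊛ tail hW)
                               ⊕ (α ◇ₗ (head hV ◇ₗ head hW)) ⋆ (tail hV ⊛ tail hW)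
  ◇W-⊛-split α {V} {W} hV@(prefixed x p _) hW@(prefixed y q _) =
    ≋-trans (◇W-congʳ α (⊛-split hV hW))
    (≋-trans (◇W-distrib-⊕ α (x ⋆ (p ⊛ W) ⊕ y ⋆ (V ⊛ q)) ((x ◇ₗ y) ⋆ (p ⊛ q)))
      (++-cong (≋-trans (◇W-distrib-⊕ α (x ⋆ (p ⊛ W)) (y ⋆ (V ⊛ q)))
                        (++-cong (◇W-⋆ α x (p ⊛ W)) (◇W-⋆ α y (V ⊛ q))))
               (◇W-⋆ α (x ◇ₗ y) (p ⊛ q))))

  ◇ₗ-comm-from-letters : (∀ a b → (a ◇ b) ≈A (b ◇ a)) → (x y : kA) → x ◇ₗ y ≋ y ◇ₗ x
  ◇ₗ-comm-from-letters ◇-comm x y = mk≋ λ f → begin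
    eval (x ◇ₗ y) f                             ≈⟨ eval-◇ₗ x y f ⟩
    eval x (λ a → eval y (λ b → eval (a ◇ b) f)) ≈⟨ eval-cong x (λ a → eval-cong y (λ b →
                                                      eval-≈ (Coefficients.coeff⇒≋ _≟A_ (a ◇ b) (b ◇ a) (◇-comm a b)) f)) ⟩
    eval x (λ a → eval y (λ b → eval (b ◇ a) f)) ≈⟨ eval-swap x y _ ⟩
    eval y (λ b → eval x (λ a → eval (b ◇ a) f)) ≈⟨ sym (eval-◇ₗ y x f) ⟩
    eval (y ◇ₗ x) f                             ∎

  ◇ₗ-assoc-from-letters : (∀ a b d → ((a ◇ b) ◇ₗ ⟪ d ⟫) ≈A (⟪ a ⟫ ◇ₗ (b ◇ d))) →
                          (x y z : kA) → (x ◇ₗ y) ◇ₗ z ≋ x ◇ₗ (y ◇ₗ z)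
  ◇ₗ-assoc-from-letters ◇-assoc x y z = mk≋ λ f → begin
      eval ((x ◇ₗ y) ◇ₗ z) f
    ≈⟨ eval-◇ₗ (x ◇ₗ y) z f ⟩
      eval (x ◇ₗ y) (λ m → eval z (λ d → eval (m ◇ d) f))
    ≈⟨ eval-◇ₗ x y _ ⟩
      eval x (λ a → eval y (λ b → eval (a ◇ b) (λ m → eval z (λ d → eval (m ◇ d) f))))
    ≈⟨ eval-cong x (λ a → eval-cong y (λ b → eval-swap (a ◇ b) z _)) ⟩
      eval x (λ a → eval y (λ b → eval z (λ d → eval (a ◇ b) (λ m → eval (m ◇ d) f))))
    ≈⟨ eval-cong x (λ a → eval-cong y (λ b → eval-cong z (λ d → letters a b d f))) ⟩
      eval x (λ a → eval y (λ b → eval z (λ d → eval (b ◇ d) (λ m → eval (a ◇ m) f))))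
    ≈⟨ sym (eval-cong x (λ a → eval-◇ₗ y z _)) ⟩
      eval x (λ a → eval (y ◇ₗ z) (λ m → eval (a ◇ m) f))
    ≈⟨ sym (eval-◇ₗ x (y ◇ₗ z) f) ⟩
      eval (x ◇ₗ (y ◇ₗ z)) f ∎
    where
    letters : ∀ a b d (f : A → Carrier) →
              eval (a ◇ b) (λ m → eval (m ◇ d) f) ≈ eval (b ◇ d) (λ m → eval (a ◇ m) f)
    letters a b d f = begin
      eval (a ◇ b) (λ m → eval (m ◇ d) f)
        ≈⟨ sym (eval-cong (a ◇ b) (λ m → eval-unit d (λ n → eval (m ◇ n) f))) ⟩
      eval (a ◇ b) (λ m → eval ⟪ d ⟫ (λ n → eval (m ◇ n) f))  ≈⟨ sym (eval-◇ₗ (a ◇ b) ⟪ d ⟫ f) ⟩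
      eval ((a ◇ b) ◇ₗ ⟪ d ⟫) f                               ≈⟨ eval-≈ (Coefficients.coeff⇒≋ _≟A_ ((a ◇ b) ◇ₗ ⟪ d ⟫) (⟪ a ⟫ ◇ₗ (b ◇ d)) (◇-assoc a b d)) f ⟩
      eval (⟪ a ⟫ ◇ₗ (b ◇ d)) f                               ≈⟨ eval-◇ₗ ⟪ a ⟫ (b ◇ d) f ⟩
      eval ⟪ a ⟫ (λ n → eval (b ◇ d) (λ m → eval (n ◇ m) f))  ≈⟨ eval-unit a (λ n → eval (b ◇ d) (λ m → eval (n ◇ m) f)) ⟩
      eval (b ◇ d) (λ m → eval (a ◇ m) f)                     ∎

module Identities {c ℓ} (K : Field c ℓ) {A : Set} (_≟A_ : DecidableEquality A)
                  (_◇_ : A → A → List (Field.Carrier K × A)) where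
  open Field K using (commutativeRing; 1#; _+_)
  open QuasiShuffle K _≟A_ _◇_
  open Evaluation commutativeRing
  open Calculus K _≟A_ _◇_
  open Prefixed
  open import Relation.Binary.Reasoning.Setoid (≋-setoid (Word A))
  import Algebra.Solver.CommutativeMonoid (++-commutativeMonoid (Word A)) as ⊕-Solver
  open ⊕-Solver using (solve; _⊜_) renaming (_⊕_ to _⊞_)

  module _ (◇-comm : ∀ a b → (a ◇ b) ≈A (b ◇ a))
           (◇-assoc : ∀ a b d → ((a ◇ b) ◇ₗ ⟪ d ⟫) ≈A (⟪ a ⟫ ◇ₗ (b ◇ d))) where

    ◇ₗ-commutativeSemigroup : CommutativeSemigroup c (c ⊔ ℓ)
    ◇ₗ-commutativeSemigroup = record
      { Carrier = kA ; _≈_ = _≋_ ; _∙_ = _◇ₗ_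
      ; isCommutativeSemigroup = record
        { isSemigroup = record
          { isMagma = record { isEquivalence = Setoid.isEquivalence (≋-setoid A) ; ∙-cong = ◇ₗ-cong }
          ; assoc = ◇ₗ-assoc-from-letters ◇-assoc }
        ; comm = ◇ₗ-comm-from-letters ◇-comm } }

    open CommutativeSemigroup ◇ₗ-commutativeSemigroup using ()
      renaming (assoc to ◇ₗ-assoc; comm to ◇ₗ-comm)
    open import Algebra.Properties.CommutativeSemigroup ◇ₗ-commutativeSemigroup
      using () renaming (x∙yz≈y∙xz to ◇ₗ-left-comm; interchange to ◇ₗ-interchange)

    identity₁ : (a b : A) {V : kW} → Prefixed V →
                a ◆ (V ⊛ ⟦ b ∷ [] ⟧) ⊕ b ▹ (a ◆ V) ≋ (a ◆ V) ⊛ ⟦ b ∷ [] ⟧ ⊕ a ◆ (b ▹ V)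
    identity₁ a b {V} hV = begin
        a ◆ (V ⊛ ⟦ b ∷ [] ⟧) ⊕ b ▹ (a ◆ V)
      ≈⟨ ++-cong (≋-trans (◇W-⊛-split ⟪ a ⟫ hV hb)
                          (⊕₃-cong (≋-refl {x = T₁}) (⋆-congʳ (⟪ a ⟫ ◇ₗ ⟪ b ⟫) (⊛-unitʳ V))
                                   (⋆-congˡ (p ⊛ ⟦ [] ⟧) (≋-sym (◇ₗ-assoc ⟪ a ⟫ x ⟪ b ⟫)))))
                 (⋆-congʳ ⟪ b ⟫ (split haV)) ⟩
        (T₁ ⊕ T₂ ⊕ T₃) ⊕ T₄
      ≈⟨ regroup T₁ T₂ T₃ T₄ ⟩
        (T₁ ⊕ T₄ ⊕ T₃) ⊕ T₂
      ≈⟨ ≋-sym (++-cong (≋-trans (⊛-split haV hb)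
                                 (⊕₃-cong (≋-refl {x = T₁})
                                          (⋆-congʳ ⟪ b ⟫ (≋-trans (⊛-unitʳ (a ◆ V)) (split haV)))
                                          (≋-refl {x = T₃})))
                        (◇W-⋆ ⟪ a ⟫ ⟪ b ⟫ V)) ⟩
        (a ◆ V) ⊛ ⟦ b ∷ [] ⟧ ⊕ a ◆ (b ▹ V) ∎
      where
      x = head hV
      p = tail hV
      hb = word-prefixed b []
      haV = ◇W-prefixed ⟪ a ⟫ hV
      T₁ = (⟪ a ⟫ ◇ₗ x) ⋆ (p ⊛ ⟦ b ∷ [] ⟧)
      T₂ = (⟪ a ⟫ ◇ₗ ⟪ b ⟫) ⋆ V
      T₃ = ((⟪ a ⟫ ◇ₗ x) ◇ₗ ⟪ b ⟫) ⋆ (p ⊛ ⟦ [] ⟧)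
      T₄ = ⟪ b ⟫ ⋆ ((⟪ a ⟫ ◇ₗ x) ⋆ p)
      regroup : ∀ t₁ t₂ t₃ t₄ → (t₁ ⊕ t₂ ⊕ t₃) ⊕ t₄ ≋ (t₁ ⊕ t₄ ⊕ t₃) ⊕ t₂
      regroup = solve 4 (λ t₁ t₂ t₃ t₄ → ((t₁ ⊞ t₂) ⊞ t₃) ⊞ t₄ ⊜ ((t₁ ⊞ t₄) ⊞ t₃) ⊞ t₂) ≋-refl

    identity₂ : (a b : A) {V W : kW} → Prefixed V → Prefixed W →
                (a ◆ V) ⊛ (b ◆ W) ≋ a ◆ (V ⊛ (b ◆ W)) ⊕ b ◆ ((a ◆ V) ⊛ W) ⊖ (a ◇ b) ◇W (V ⊛ W)
    identity₂ a b {V} {W} hV hW = begin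
        (a ◆ V) ⊛ (b ◆ W)
      ≈⟨ ⊛-split haV hbW ⟩
        L₁ ⊕ L₂ ⊕ L₃
      ≈⟨ ≋-sym (⊖-cancel (L₁ ⊕ L₂ ⊕ L₃) (M₂ ⊕ M₁ ⊕ L₃)) ⟩
        (L₁ ⊕ L₂ ⊕ L₃) ⊕ (M₂ ⊕ M₁ ⊕ L₃) ⊖ (M₂ ⊕ M₁ ⊕ L₃)
      ≈⟨ ⊖-cong (regroup L₁ L₂ L₃ M₁ M₂) (≋-refl {x = M₂ ⊕ M₁ ⊕ L₃}) ⟩
        (L₁ ⊕ M₁ ⊕ L₃) ⊕ (M₂ ⊕ L₂ ⊕ L₃) ⊖ (M₂ ⊕ M₁ ⊕ L₃)
      ≈⟨ ≋-sym (⊖-cong (++-cong a-first b-first) ab-first) ⟩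
        a ◆ (V ⊛ (b ◆ W)) ⊕ b ◆ ((a ◆ V) ⊛ W) ⊖ (a ◇ b) ◇W (V ⊛ W) ∎
      where
      x = head hV
      p = tail hV
      y = head hW
      q = tail hW
      haV = ◇W-prefixed ⟪ a ⟫ hV
      hbW = ◇W-prefixed ⟪ b ⟫ hW
      ab = ⟪ a ⟫ ◇ₗ ⟪ b ⟫
      L₁ = (⟪ a ⟫ ◇ₗ x) ⋆ (p ⊛ (b ◆ W))
      L₂ = (⟪ b ⟫ ◇ₗ y) ⋆ ((a ◆ V) ⊛ q)
      L₃ = ((⟪ a ⟫ ◇ₗ x) ◇ₗ (⟪ b ⟫ ◇ₗ y)) ⋆ (p ⊛ q)
      M₁ = (ab ◇ₗ y) ⋆ (V ⊛ q)
      M₂ = (ab ◇ₗ x) ⋆ (p ⊛ W)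
      a-first : a ◆ (V ⊛ (b ◆ W)) ≋ L₁ ⊕ M₁ ⊕ L₃
      a-first = ≋-trans (◇W-⊛-split ⟪ a ⟫ hV hbW)
        (⊕₃-cong (≋-refl {x = L₁})
                 (⋆-congˡ (V ⊛ q) (≋-sym (◇ₗ-assoc ⟪ a ⟫ ⟪ b ⟫ y)))
                 (⋆-congˡ (p ⊛ q) (≋-sym (◇ₗ-assoc ⟪ a ⟫ x (⟪ b ⟫ ◇ₗ y)))))
      b-first : b ◆ ((a ◆ V) ⊛ W) ≋ M₂ ⊕ L₂ ⊕ L₃
      b-first = ≋-trans (◇W-⊛-split ⟪ b ⟫ haV hW)
        (⊕₃-cong (⋆-congˡ (p ⊛ W) (≋-trans (◇ₗ-left-comm ⟪ b ⟫ ⟪ a ⟫ x) (≋-sym (◇ₗ-assoc ⟪ a ⟫ ⟪ b ⟫ x))))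
                 (≋-refl {x = L₂})
                 (⋆-congˡ (p ⊛ q) (◇ₗ-left-comm ⟪ b ⟫ (⟪ a ⟫ ◇ₗ x) y)))
      ab-first : (a ◇ b) ◇W (V ⊛ W) ≋ M₂ ⊕ M₁ ⊕ L₃
      ab-first = ≋-trans (◇W-congˡ (V ⊛ W) (≋-sym (◇ₗ-letters a b)))
        (≋-trans (◇W-⊛-split ab hV hW)
          (⊕₃-cong (≋-refl {x = M₂}) (≋-refl {x = M₁})
                   (⋆-congˡ (p ⊛ q) (◇ₗ-interchange ⟪ a ⟫ ⟪ b ⟫ x y))))
      regroup : ∀ l₁ l₂ l₃ m₁ m₂ → (l₁ ⊕ l₂ ⊕ l₃) ⊕ (m₂ ⊕ m₁ ⊕ l₃) ≋ (l₁ ⊕ m₁ ⊕ l₃) ⊕ (m₂ ⊕ l₂ ⊕ l₃)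
      regroup = solve 5 (λ l₁ l₂ l₃ m₁ m₂ →
        ((l₁ ⊞ l₂) ⊞ l₃) ⊞ ((m₂ ⊞ m₁) ⊞ l₃) ⊜ ((l₁ ⊞ m₁) ⊞ l₃) ⊞ ((m₂ ⊞ l₂) ⊞ l₃)) ≋-refl

    identity₃ : (a b : A) {V W : kW} → Prefixed V → Prefixed W →
                a ▹ (V ⊛ (b ◆ W)) ⊕ a ◆ (V ⊛ (b ▹ W)) ⊕ b ▹ ((a ◆ V) ⊛ W) ⊕ b ◆ ((a ▹ V) ⊛ W)
                ≋ (a ▹ V) ⊛ (b ◆ W) ⊕ (a ◆ V) ⊛ (b ▹ W) ⊕ (1# + 1#) · ((a ◇ b) ⋆ (V ⊛ W))
    identity₃ a b {V} {W} hV hW = begin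
        T₁ ⊕ a ◆ (V ⊛ (b ▹ W)) ⊕ T₃ ⊕ b ◆ ((a ▹ V) ⊛ W)
      ≈⟨ ++-cong (++-cong (++-cong (≋-refl {x = T₁}) a-middle) (≋-refl {x = T₃})) b-last ⟩
        T₁ ⊕ (A₁ ⊕ Z ⊕ A₃) ⊕ T₃ ⊕ (Z ⊕ B₂ ⊕ B₃)
      ≈⟨ regroup T₁ A₁ Z A₃ T₃ B₂ B₃ ⟩
        (T₁ ⊕ B₂ ⊕ B₃) ⊕ (A₁ ⊕ T₃ ⊕ A₃) ⊕ (Z ⊕ Z)
      ≈⟨ ⊕₃-cong (≋-sym (⊛-split haV′ hbW)) (≋-sym (⊛-split haV hbW′)) (⊕-double Z) ⟩
        (a ▹ V) ⊛ (b ◆ W) ⊕ (a ◆ V) ⊛ (b ▹ W) ⊕ (1# + 1#) · Z ∎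
      where
      x = head hV
      p = tail hV
      y = head hW
      q = tail hW
      haV = ◇W-prefixed ⟪ a ⟫ hV
      hbW = ◇W-prefixed ⟪ b ⟫ hW
      haV′ = ⋆-prefixed ⟪ a ⟫ V
      hbW′ = ⋆-prefixed ⟪ b ⟫ W
      T₁ = a ▹ (V ⊛ (b ◆ W))
      T₃ = b ▹ ((a ◆ V) ⊛ W)
      Z  = (a ◇ b) ⋆ (V ⊛ W)
      A₁ = (⟪ a ⟫ ◇ₗ x) ⋆ (p ⊛ (b ▹ W))
      A₃ = ((⟪ a ⟫ ◇ₗ x) ◇ₗ ⟪ b ⟫) ⋆ (p ⊛ W)
      B₂ = (⟪ b ⟫ ◇ₗ y) ⋆ ((a ▹ V) ⊛ q)
      B₃ = (⟪ a ⟫ ◇ₗ (⟪ b ⟫ ◇ₗ y)) ⋆ (V ⊛ q)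
      a-middle : a ◆ (V ⊛ (b ▹ W)) ≋ A₁ ⊕ Z ⊕ A₃
      a-middle = ≋-trans (◇W-⊛-split ⟪ a ⟫ hV hbW′)
        (⊕₃-cong (≋-refl {x = A₁})
                 (⋆-congˡ (V ⊛ W) (◇ₗ-letters a b))
                 (⋆-congˡ (p ⊛ W) (≋-sym (◇ₗ-assoc ⟪ a ⟫ x ⟪ b ⟫))))
      b-last : b ◆ ((a ▹ V) ⊛ W) ≋ Z ⊕ B₂ ⊕ B₃
      b-last = ≋-trans (◇W-⊛-split ⟪ b ⟫ haV′ hW)
        (⊕₃-cong (⋆-congˡ (V ⊛ W) (≋-trans (◇ₗ-comm ⟪ b ⟫ ⟪ a ⟫) (◇ₗ-letters a b)))
                 (≋-refl {x = B₂})
                 (⋆-congˡ (V ⊛ q) (◇ₗ-left-comm ⟪ b ⟫ ⟪ a ⟫ y)))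
      regroup : ∀ t₁ a₁ z a₃ t₃ b₂ b₃ →
                t₁ ⊕ (a₁ ⊕ z ⊕ a₃) ⊕ t₃ ⊕ (z ⊕ b₂ ⊕ b₃) ≋ (t₁ ⊕ b₂ ⊕ b₃) ⊕ (a₁ ⊕ t₃ ⊕ a₃) ⊕ (z ⊕ z)
      regroup = solve 7 (λ t₁ a₁ z a₃ t₃ b₂ b₃ →
        ((t₁ ⊞ ((a₁ ⊞ z) ⊞ a₃)) ⊞ t₃) ⊞ ((z ⊞ b₂) ⊞ b₃)
          ⊜ (((t₁ ⊞ b₂) ⊞ b₃) ⊞ ((a₁ ⊞ t₃) ⊞ a₃)) ⊞ (z ⊞ z)) ≋-refl

lemma1 : ∀ {c ℓ : Level} (K : Field c ℓ) (A : Set) (countable : A ↣ ℕ)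
         (_◇_ : A → A → List (Field.Carrier K × A)) →
         let open Field K
             open QuasiShuffle K (countable-dec countable) _◇_
         in (∀ a b → (a ◇ b) ≈A (b ◇ a)) →
            (∀ a b d → ((a ◇ b) ◇ₗ ((1# , d) ∷ [])) ≈A (((1# , a) ∷ []) ◇ₗ (b ◇ d))) →
            ∀ (a b : A) (v w : List A) → v ≢ [] → w ≢ [] →
            ((a ◆ (⟦ v ⟧ ⊛ ⟦ b ∷ [] ⟧)) ⊕ (b ▹ (a ◆ ⟦ v ⟧))
               ≈W ((a ◆ ⟦ v ⟧) ⊛ ⟦ b ∷ [] ⟧) ⊕ (a ◆ ⟦ b ∷ v ⟧))
            × ((a ◆ ⟦ v ⟧) ⊛ (b ◆ ⟦ w ⟧)
               ≈W (a ◆ (⟦ v ⟧ ⊛ (b ◆ ⟦ w ⟧))) ⊕ (b ◆ ((a ◆ ⟦ v ⟧) ⊛ ⟦ w ⟧))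
                    ⊖ ((a ◇ b) ◇W (⟦ v ⟧ ⊛ ⟦ w ⟧)))
            × ((a ▹ (⟦ v ⟧ ⊛ (b ◆ ⟦ w ⟧))) ⊕ (a ◆ (⟦ v ⟧ ⊛ ⟦ b ∷ w ⟧))
                 ⊕ (b ▹ ((a ◆ ⟦ v ⟧) ⊛ ⟦ w ⟧)) ⊕ (b ◆ (⟦ a ∷ v ⟧ ⊛ ⟦ w ⟧))
               ≈W (⟦ a ∷ v ⟧ ⊛ (b ◆ ⟦ w ⟧)) ⊕ ((a ◆ ⟦ v ⟧) ⊛ ⟦ b ∷ w ⟧)
                    ⊕ ((1# + 1#) · ((a ◇ b) ⋆ (⟦ v ⟧ ⊛ ⟦ w ⟧))))
lemma1 K A countable _◇_ ◇-comm ◇-assoc a b []       _        v≢[] _    = ⊥-elim (v≢[] ≡.refl)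
lemma1 K A countable _◇_ ◇-comm ◇-assoc a b (_ ∷ _)  []       _    w≢[] = ⊥-elim (w≢[] ≡.refl)
lemma1 K A countable _◇_ ◇-comm ◇-assoc a b (c ∷ v′) (e ∷ w′) _    _    =
  ≋⇒coeff first , ≋⇒coeff second , ≋⇒coeff third
  where
  open Field K using (1#; _+_)
  _≟A_ = countable-dec countable
  open QuasiShuffle K _≟A_ _◇_
  open Evaluation (Field.commutativeRing K)
  open Calculus K _≟A_ _◇_
  open Coefficients (≡-dec _≟A_) using (≋⇒coeff)
  open Identities K _≟A_ _◇_

  V W : kW
  V = ⟦ c ∷ v′ ⟧
  W = ⟦ e ∷ w′ ⟧

  bV : ⟦ b ∷ c ∷ v′ ⟧ ≋ b ▹ V
  bV = split-word b (c ∷ v′)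
  bW : ⟦ b ∷ e ∷ w′ ⟧ ≋ b ▹ W
  bW = split-word b (e ∷ w′)
  aV : ⟦ a ∷ c ∷ v′ ⟧ ≋ a ▹ V
  aV = split-word a (c ∷ v′)

  first : a ◆ (V ⊛ ⟦ b ∷ [] ⟧) ⊕ b ▹ (a ◆ V) ≋ (a ◆ V) ⊛ ⟦ b ∷ [] ⟧ ⊕ a ◆ ⟦ b ∷ c ∷ v′ ⟧
  first = ≋-trans (identity₁ ◇-comm ◇-assoc a b (word-prefixed c v′))
                  (++-cong (≋-refl {x = (a ◆ V) ⊛ ⟦ b ∷ [] ⟧}) (◇W-congʳ ⟪ a ⟫ (≋-sym bV)))

  second : (a ◆ V) ⊛ (b ◆ W) ≋ a ◆ (V ⊛ (b ◆ W)) ⊕ b ◆ ((a ◆ V) ⊛ W) ⊖ (a ◇ b) ◇W (V ⊛ W)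
  second = identity₂ ◇-comm ◇-assoc a b (word-prefixed c v′) (word-prefixed e w′)

  third : a ▹ (V ⊛ (b ◆ W)) ⊕ a ◆ (V ⊛ ⟦ b ∷ e ∷ w′ ⟧) ⊕ b ▹ ((a ◆ V) ⊛ W) ⊕ b ◆ (⟦ a ∷ c ∷ v′ ⟧ ⊛ W)
          ≋ ⟦ a ∷ c ∷ v′ ⟧ ⊛ (b ◆ W) ⊕ (a ◆ V) ⊛ ⟦ b ∷ e ∷ w′ ⟧ ⊕ (1# + 1#) · ((a ◇ b) ⋆ (V ⊛ W))
  third = ≋-trans
    (++-cong (++-cong (++-cong (≋-refl {x = a ▹ (V ⊛ (b ◆ W))}) (◇W-congʳ ⟪ a ⟫ (⊛-congʳ V bW)))
                      (≋-refl {x = b ▹ ((a ◆ V) ⊛ W)}))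
             (◇W-congʳ ⟪ b ⟫ (⊛-congˡ W aV)))
    (≋-trans (identity₃ ◇-comm ◇-assoc a b (word-prefixed c v′) (word-prefixed e w′))
      (⊕₃-cong (⊛-congˡ (b ◆ W) (≋-sym aV)) (⊛-congʳ (a ◆ V) (≋-sym bW))
               (≋-refl {x = (1# + 1#) · ((a ◇ b) ⋆ (V ⊛ W))})))
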